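{- As $n\to\infty$, $$ \max_{f \in \mathfrak{T}(2,n,2)} J(f, \mathfrak{T}(2,n,2)) = \Omega(n^2). $$
   Context: Let $E_n^2=\{0,1,\dots,n-1\}^2$. For $f:E_n^2\to\{0,1\}$ let $M_1(f)=\{x\in E_n^2: f(x)=1\}$. $\mathfrak{T}(2,n,2)$ is the class of functions $f:E_n^2\to\{0,1\}$ for which there are real numbers $a_{ij}$ with $M_1(f)=\{x\in E_n^2: a_{i1}x_1+a_{i2}x_2\le a_{i0},\ i=1,2\}$. For a class $\mathcal{C}$ of functions on a domain $X$ and $f\in\mathcal{C}$, a teaching set of $f$ with respect to $\mathcal{C}$ is a set $T\subseteq X$ such that the only function in $\mathcal{C}$ agreeing with $f$ on $T$ is $f$; it is minimal if no proper subset of it is a teaching set. $J(f,\mathcal{C})$ is the number of minimal teaching sets of $f$ with respect to $\mathcal{C}$.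
   Formalization: The coefficients $a_{ij}$ defining $\mathfrak{T}(2,n,2)$ are rational rather than real, so this applies to f and to the functions competing with it in the definition of a teaching set. -}

module Defs where

open import Data.Bool using (Bool; true; false)
open import Data.Nat as ℕ using (ℕ)
open import Data.Fin using (Fin; toℕ)
open import Data.Integer using (+_)
open import Data.Rational using (ℚ; _/_; _+_; _*_; _≤_)
open import Data.Product using (Σ; _×_; _,_; ∃; ∃-syntax; proj₁; proj₂)
open import Function.Bundles using (_⇔_)
open import Relation.Binary.PropositionalEquality using (_≡_; _≢_)
open import Relation.Nullary using (¬_)

Point : ℕ → Set
Point n = Fin n × Fin n

BFun : ℕ → Set
BFun n = Point n → Bool

Subset² : ℕ → Set
Subset² n = Point n → Bool

coord : {n : ℕ} → Fin n → ℚ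
coord i = (+ toℕ i) / 1

InHalfPlane : {n : ℕ} → ℚ × ℚ × ℚ → Point n → Set
InHalfPlane (a₀ , a₁ , a₂) (x₁ , x₂) = (a₁ * coord x₁) + (a₂ * coord x₂) ≤ a₀

InT : (n : ℕ) → BFun n → Set
InT n f = Σ (ℚ × ℚ × ℚ) λ h₁ → Σ (ℚ × ℚ × ℚ) λ h₂ →
  (x : Point n) → (f x ≡ true) ⇔ (InHalfPlane h₁ x × InHalfPlane h₂ x)

AgreeOn : {n : ℕ} → Subset² n → BFun n → BFun n → Set
AgreeOn {n} T f g = (x : Point n) → T x ≡ true → g x ≡ f x

IsTeachingSet : (n : ℕ) → BFun n → Subset² n → Set
IsTeachingSet n f T = (g : BFun n) → InT n g → AgreeOn T f g → (x : Point n) → g x ≡ f x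

_⊂_ : {n : ℕ} → Subset² n → Subset² n → Set
_⊂_ {n} S T = ((x : Point n) → S x ≡ true → T x ≡ true) × (∃[ x ] (T x ≡ true × S x ≡ false))

IsMinimalTeachingSet : (n : ℕ) → BFun n → Subset² n → Set
IsMinimalTeachingSet n f T =
  IsTeachingSet n f T × ((S : Subset² n) → S ⊂ T → ¬ IsTeachingSet n f S)

J≥ : (n : ℕ) → BFun n → ℕ → Set
J≥ n f k = Σ (Fin k → Subset² n) λ Ts →
  ((i : Fin k) → IsMinimalTeachingSet n f (Ts i)) ×
  ((i j : Fin k) → i ≢ j → ∃[ x ] (Ts i x ≢ Ts j x))

-- Take M₁(f⋆) = {(1,1), (2,1)} and, for a, b < n − 4, let T⋆ a b consist of the
-- points (x,0) with x ≠ 3, (x,1) with x ≤ 3, (0,2) and (x,2) with x ≥ 4, together with the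
-- diagonal point (4+a, 4+a) and the vertical point (1, 4+b).  Every T⋆ a b is a minimal
-- teaching set of f⋆, which gives (n − 4)² ≥ n²/4 of them once n ≥ 8.
--
-- Teaching: a competitor g agreeing with f⋆ on T⋆ a b is {φ ≤ 0} ∩ {ψ ≤ 0} for two additive
-- forms on homogeneous coordinates, φ being the one that excludes (3,1).  Sign bookkeeping
-- along lattice identities such as (4,0) + (0,2) = (2,1) + (2,1) removes every point of rows
-- 0–2 outside M₁, and convexity of g pushes any point above row 2 down to row 2.  The crux is
-- (2,2): if g contained it, then g would contain the vertical ray from (1,1), or the diagonal
-- ray from (2,2), or the origin; the single points (1,4+b) and (4+a,4+a) of T⋆ a b rule out the
-- rays, whichever a and b are, and that freedom is where the n² comes from.
--
-- Minimality: for every t ∈ T⋆ a b there is an explicit intersection of two half-planes that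
-- agrees with f⋆ on T⋆ a b except at t.

module Submission where

open import Defs
open import Data.Nat using (ℕ; _≤_; _*_; suc)
open import Data.Product using (Σ; _×_; ∃-syntax)

open import Algebra.Properties.Group using (identityˡ-unique)
open import Data.Bool using (Bool; true; false; T; not; _∧_; _∨_)
open import Data.Bool.Properties using (¬-not; not-¬; ∧-zeroʳ; T-≡; T-∧; T-∨)
open import Data.Empty using (⊥; ⊥-elim)
open import Data.Fin using (Fin; toℕ; fromℕ<; zero; suc; _↑ʳ_; remQuot; combine)
open import Data.Fin.Properties using (toℕ-fromℕ<; toℕ<n; toℕ-injective; combine-remQuot)
import Data.Integer as ℤ
import Data.Integer.Properties as ℤₚ
open import Data.Nat as ℕ using (zero; _+_; _<_; z≤n; s≤s; _<ᵇ_; _≡ᵇ_; _≤ᵇ_)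
open import Data.Nat.Coprimality using (1-coprimeTo)
import Data.Nat.Coprimality as Coprime
open import Data.Nat.DivMod using (_/_; _%_; m≡m%n+[m/n]*n; m%n<n)
import Data.Nat.Properties as ℕₚ
open import Data.Nat.Tactic.RingSolver using (solve-∀)
open import Data.Product using (_,_; proj₁; proj₂; swap; uncurry)
open import Data.Product.Function.NonDependent.Propositional using (_×-⇔_)
open import Data.Rational as ℚ using (ℚ; 0ℚ; 1ℚ; mkℚ)
import Data.Rational.Properties as ℚₚ
open import Data.Rational.Solver using (module +-*-Solver)
open import Data.Sum using (_⊎_; inj₁; inj₂)
open import Function using (_∘_)
open import Function.Bundles using (_⇔_; mk⇔; Equivalence)
import Function.Properties.Equivalence as ⇔
open import Relation.Binary.Definitions using (tri<; tri≈; tri>)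
open import Relation.Binary.PropositionalEquality
open import Relation.Nullary using (¬_; yes; no)

true≢false : true ≢ false
true≢false ()

-- Opaque, because unfolding _/_ at a symbolic numerator makes Agda normalise gcd's.
opaque
  ι : ℕ → ℚ
  ι n = ℤ.+ n ℚ./ 1

  ι-coord : ∀ {n} (i : Fin n) → coord i ≡ ι (toℕ i)
  ι-coord i = refl

  ι-1 : ι 1 ≡ 1ℚ
  ι-1 = refl

  ι≡mkℚ : ∀ n → ι n ≡ mkℚ (ℤ.+ n) 0 (Coprime.sym (1-coprimeTo n))
  ι≡mkℚ n = ℚₚ.normalize-coprime (Coprime.sym (1-coprimeTo n))

  ι-+ : ∀ m n → ι (m + n) ≡ ι m ℚ.+ ι n
  ι-+ m n rewrite ι≡mkℚ m | ι≡mkℚ n =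
    cong (ℚ._/ 1) (sym (cong₂ ℤ._+_ (ℤₚ.*-identityʳ (ℤ.+ m)) (ℤₚ.*-identityʳ (ℤ.+ n))))

  ι-* : ∀ m n → ι (m * n) ≡ ι m ℚ.* ι n
  ι-* m n rewrite ι≡mkℚ m | ι≡mkℚ n = cong (ℚ._/ 1) (ℤₚ.pos-* m n)

  ι-mono-≤ : ∀ {m n} → m ≤ n → ι m ℚ.≤ ι n
  ι-mono-≤ {m} {n} m≤n rewrite ι≡mkℚ m | ι≡mkℚ n =
    ℚ.*≤* (subst₂ ℤ._≤_ (sym (ℤₚ.*-identityʳ (ℤ.+ m))) (sym (ℤₚ.*-identityʳ (ℤ.+ n)))
                        (ℤ.+≤+ m≤n))

  ι-cancel-≤ : ∀ {m n} → ι m ℚ.≤ ι n → m ≤ n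
  ι-cancel-≤ {m} {n} ιm≤ιn rewrite ι≡mkℚ m | ι≡mkℚ n with ιm≤ιn
  ... | ℚ.*≤* le =
    ℤₚ.drop‿+≤+ (subst₂ ℤ._≤_ (ℤₚ.*-identityʳ (ℤ.+ m)) (ℤₚ.*-identityʳ (ℤ.+ n)) le)

-- Homogeneous coordinates: the grid point (x, y) is pt x y = (x, y, 1) and directions have
-- weight 0, so the half-plane a₁x + a₂y ≤ a₀ becomes {v | form h v ≤ 0} for the additive form
-- (x, y, w) ↦ a₁x + a₂y − a₀w, and is closed under sums and multiples.
ℕ³ : Set
ℕ³ = ℕ × ℕ × ℕ

infixl 6 _⊕_
infixr 7 _·_

_⊕_ : ℕ³ → ℕ³ → ℕ³
(x , y , w) ⊕ (x′ , y′ , w′) = (x + x′ , y + y′ , w + w′)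

_·_ : ℕ → ℕ³ → ℕ³
k · (x , y , w) = (k * x , k * y , k * w)

pt : ℕ → ℕ → ℕ³
pt x y = (x , y , 1)

dir : ℕ → ℕ → ℕ³
dir x y = (x , y , 0)

ray→ : ∀ x y k → pt x y ⊕ k · dir 1 0 ≡ pt (x + k) y
ray→ x y k rewrite ℕₚ.*-identityʳ k | ℕₚ.*-zeroʳ k | ℕₚ.+-identityʳ y = refl

ray↑ : ∀ x y k → pt x y ⊕ k · dir 0 1 ≡ pt x (y + k)
ray↑ x y k rewrite ℕₚ.*-identityʳ k | ℕₚ.*-zeroʳ k | ℕₚ.+-identityʳ x = refl

ray↗ : ∀ x y k → pt x y ⊕ k · dir 1 1 ≡ pt (x + k) (y + k)
ray↗ x y k rewrite ℕₚ.*-identityʳ k | ℕₚ.*-zeroʳ k = refl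

module AdditiveForm (φ : ℕ³ → ℚ) (φ-⊕ : ∀ u v → φ (u ⊕ v) ≡ φ u ℚ.+ φ v) where

  private
    <⇒≱ : ∀ {p q} → p ℚ.< q → ¬ (q ℚ.≤ p)
    <⇒≱ p<q q≤p = ℚₚ.<-irrefl refl (ℚₚ.<-≤-trans p<q q≤p)

  φ-𝟘 : φ (0 , 0 , 0) ≡ 0ℚ
  φ-𝟘 = identityˡ-unique ℚₚ.+-0-group _ _ (sym (φ-⊕ (0 , 0 , 0) (0 , 0 , 0)))

  nonPos-or-pos : ∀ v → φ v ℚ.≤ 0ℚ ⊎ 0ℚ ℚ.< φ v
  nonPos-or-pos v with φ v ℚₚ.≤? 0ℚ
  ... | yes φv≤0 = inj₁ φv≤0
  ... | no  φv≰0 = inj₂ (ℚₚ.≰⇒> φv≰0)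

  nonPos-⊕ : ∀ {u v} → φ u ℚ.≤ 0ℚ → φ v ℚ.≤ 0ℚ → φ (u ⊕ v) ℚ.≤ 0ℚ
  nonPos-⊕ {u} {v} φu≤0 φv≤0 = subst (ℚ._≤ 0ℚ) (sym (φ-⊕ u v)) (ℚₚ.+-mono-≤ φu≤0 φv≤0)

  nonNeg-⊕ : ∀ {u v} → 0ℚ ℚ.≤ φ u → 0ℚ ℚ.≤ φ v → 0ℚ ℚ.≤ φ (u ⊕ v)
  nonNeg-⊕ {u} {v} 0≤φu 0≤φv = subst (0ℚ ℚ.≤_) (sym (φ-⊕ u v)) (ℚₚ.+-mono-≤ 0≤φu 0≤φv)

  pos-⊕ : ∀ {u v} → 0ℚ ℚ.< φ u → 0ℚ ℚ.≤ φ v → 0ℚ ℚ.< φ (u ⊕ v)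
  pos-⊕ {u} {v} 0<φu 0≤φv = subst (0ℚ ℚ.<_) (sym (φ-⊕ u v)) (ℚₚ.+-mono-<-≤ 0<φu 0≤φv)

  pos-cancel : ∀ {u v} → 0ℚ ℚ.< φ (u ⊕ v) → φ u ℚ.≤ 0ℚ → 0ℚ ℚ.< φ v
  pos-cancel 0<φuv φu≤0 = ℚₚ.≰⇒> (λ φv≤0 → <⇒≱ 0<φuv (nonPos-⊕ φu≤0 φv≤0))

  neg-cancel : ∀ {u v} → φ (u ⊕ v) ℚ.≤ 0ℚ → 0ℚ ℚ.< φ u → φ v ℚ.< 0ℚ
  neg-cancel φuv≤0 0<φu = ℚₚ.≰⇒> (λ 0≤φv → <⇒≱ (pos-⊕ 0<φu 0≤φv) φuv≤0)

  nonPos-· : ∀ k {v} → φ v ℚ.≤ 0ℚ → φ (k · v) ℚ.≤ 0ℚ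
  nonPos-· zero    _     = ℚₚ.≤-reflexive φ-𝟘
  nonPos-· (suc k) φv≤0 = nonPos-⊕ φv≤0 (nonPos-· k φv≤0)

  nonNeg-· : ∀ k {v} → 0ℚ ℚ.≤ φ v → 0ℚ ℚ.≤ φ (k · v)
  nonNeg-· zero    _     = ℚₚ.≤-reflexive (sym φ-𝟘)
  nonNeg-· (suc k) 0≤φv = nonNeg-⊕ 0≤φv (nonNeg-· k 0≤φv)

  pos-· : ∀ k {v} → 0ℚ ℚ.< φ v → 0ℚ ℚ.< φ (suc k · v)
  pos-· k 0<φv = pos-⊕ 0<φv (nonNeg-· k (ℚₚ.<⇒≤ 0<φv))

  nonPos-·⁻¹ : ∀ k {v} → φ (suc k · v) ℚ.≤ 0ℚ → φ v ℚ.≤ 0ℚ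
  nonPos-·⁻¹ k φkv≤0 = ℚₚ.≮⇒≥ (λ 0<φv → <⇒≱ (pos-· k 0<φv) φkv≤0)

form : ℚ × ℚ × ℚ → ℕ³ → ℚ
form (a₀ , a₁ , a₂) (x , y , w) = a₁ ℚ.* ι x ℚ.+ a₂ ℚ.* ι y ℚ.- a₀ ℚ.* ι w

form-⊕ : ∀ h u v → form h (u ⊕ v) ≡ form h u ℚ.+ form h v
form-⊕ (a₀ , a₁ , a₂) (x , y , w) (x′ , y′ , w′)
  rewrite ι-+ x x′ | ι-+ y y′ | ι-+ w w′ = distrib a₀ a₁ a₂ (ι x) (ι y) (ι w) (ι x′) (ι y′) (ι w′)
  where
  open +-*-Solver
  distrib : ∀ a₀ a₁ a₂ x y w x′ y′ w′ →
    a₁ ℚ.* (x ℚ.+ x′) ℚ.+ a₂ ℚ.* (y ℚ.+ y′) ℚ.- a₀ ℚ.* (w ℚ.+ w′) ≡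
    (a₁ ℚ.* x ℚ.+ a₂ ℚ.* y ℚ.- a₀ ℚ.* w) ℚ.+ (a₁ ℚ.* x′ ℚ.+ a₂ ℚ.* y′ ℚ.- a₀ ℚ.* w′)
  distrib = solve 9 (λ a₀ a₁ a₂ x y w x′ y′ w′ →
    a₁ :* (x :+ x′) :+ a₂ :* (y :+ y′) :- a₀ :* (w :+ w′) :=
    (a₁ :* x :+ a₂ :* y :- a₀ :* w) :+ (a₁ :* x′ :+ a₂ :* y′ :- a₀ :* w′)) refl

≤⇔-≤0 : ∀ {p q} → p ℚ.≤ q ⇔ p ℚ.- q ℚ.≤ 0ℚ
≤⇔-≤0 {p} {q} = mk⇔
  (λ p≤q → subst (p ℚ.- q ℚ.≤_) (ℚₚ.+-inverseʳ q) (ℚₚ.+-monoˡ-≤ (ℚ.- q) p≤q))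
  (λ p-q≤0 → subst₂ ℚ._≤_ (p-q+q≡p p q) (ℚₚ.+-identityˡ q) (ℚₚ.+-monoˡ-≤ q p-q≤0))
  where
  open +-*-Solver
  p-q+q≡p : ∀ p q → p ℚ.- q ℚ.+ q ≡ p
  p-q+q≡p = solve 2 (λ p q → p :- q :+ q := p) refl

inHalfPlane⇔ : ∀ {n} h (i j : Fin n) → InHalfPlane h (i , j) ⇔ form h (pt (toℕ i) (toℕ j)) ℚ.≤ 0ℚ
inHalfPlane⇔ (a₀ , a₁ , a₂) i j =
  subst₂ (λ X Y → a₁ ℚ.* X ℚ.+ a₂ ℚ.* Y ℚ.≤ a₀ ⇔ p ℚ.- a₀ ℚ.* ι 1 ℚ.≤ 0ℚ)
         (sym (ι-coord i)) (sym (ι-coord j))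
         (subst (λ c → p ℚ.≤ a₀ ⇔ p ℚ.- a₀ ℚ.* c ℚ.≤ 0ℚ) (sym ι-1)
                (subst (λ c → p ℚ.≤ a₀ ⇔ p ℚ.- c ℚ.≤ 0ℚ) (sym (ℚₚ.*-identityʳ a₀)) ≤⇔-≤0))
  where
  p : ℚ
  p = a₁ ℚ.* ι (toℕ i) ℚ.+ a₂ ℚ.* ι (toℕ j)

f⋆ : ℕ → ℕ → Bool
f⋆ 1 1 = true
f⋆ 2 1 = true
f⋆ _ _ = false

onGrid : ∀ {n} → (ℕ → ℕ → Bool) → BFun n
onGrid h (i , j) = h (toℕ i) (toℕ j)

T⋆ : ℕ → ℕ → ℕ → ℕ → Bool
T⋆ a b x 0 = not (x ≡ᵇ 3)
T⋆ a b x 1 = x ≤ᵇ 3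
T⋆ a b x 2 = (x ≡ᵇ 0) ∨ (4 ≤ᵇ x)
T⋆ a b x (suc (suc (suc y))) = ((x ≡ᵇ 4 + a) ∧ (3 + y ≡ᵇ 4 + a)) ∨ ((x ≡ᵇ 1) ∧ (3 + y ≡ᵇ 4 + b))

data Fixed : ℕ → ℕ → Set where
  ⟨0,0⟩ : Fixed 0 0
  ⟨1,0⟩ : Fixed 1 0
  ⟨2,0⟩ : Fixed 2 0
  ⟨0,1⟩ : Fixed 0 1
  ⟨1,1⟩ : Fixed 1 1
  ⟨2,1⟩ : Fixed 2 1
  ⟨3,1⟩ : Fixed 3 1
  ⟨0,2⟩ : Fixed 0 2

data TPoint (a b : ℕ) : ℕ → ℕ → Set where
  fixed    : ∀ {x y} → Fixed x y → TPoint a b x y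
  row₀     : ∀ m → TPoint a b (4 + m) 0
  row₂     : ∀ m → TPoint a b (4 + m) 2
  diagonal : TPoint a b (4 + a) (4 + a)
  vertical : TPoint a b 1 (4 + b)

≡ᵇ-refl : ∀ m → (m ≡ᵇ m) ≡ true
≡ᵇ-refl m = Equivalence.to T-≡ (ℕₚ.≡⇒≡ᵇ m m refl)

≡ᵇ-≢ : ∀ {m k} → m ≢ k → (m ≡ᵇ k) ≡ false
≡ᵇ-≢ {m} {k} m≢k = ¬-not (m≢k ∘ ℕₚ.≡ᵇ⇒≡ m k ∘ Equivalence.from T-≡)

≡ᵇ-∧ : ∀ {m k m′ k′} → T ((m ≡ᵇ k) ∧ (m′ ≡ᵇ k′)) → m ≡ k × m′ ≡ k′
≡ᵇ-∧ {m} {k} {m′} {k′} both = let (m≡ᵇk , m′≡ᵇk′) = Equivalence.to T-∧ both in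
  ℕₚ.≡ᵇ⇒≡ m k m≡ᵇk , ℕₚ.≡ᵇ⇒≡ m′ k′ m′≡ᵇk′

TPoint⇒∈T⋆ : ∀ {a b x y} → TPoint a b x y → T⋆ a b x y ≡ true
TPoint⇒∈T⋆ (fixed ⟨0,0⟩)        = refl
TPoint⇒∈T⋆ (fixed ⟨1,0⟩)        = refl
TPoint⇒∈T⋆ (fixed ⟨2,0⟩)        = refl
TPoint⇒∈T⋆ (fixed ⟨0,1⟩)        = refl
TPoint⇒∈T⋆ (fixed ⟨1,1⟩)        = refl
TPoint⇒∈T⋆ (fixed ⟨2,1⟩)        = refl
TPoint⇒∈T⋆ (fixed ⟨3,1⟩)        = refl
TPoint⇒∈T⋆ (fixed ⟨0,2⟩)        = refl
TPoint⇒∈T⋆ (row₀ m)             = refl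
TPoint⇒∈T⋆ (row₂ m)             = refl
TPoint⇒∈T⋆ {a = a} diagonal     rewrite ≡ᵇ-refl a = refl
TPoint⇒∈T⋆ {b = b} vertical     rewrite ≡ᵇ-refl b = refl

∈T⋆⇒TPoint : ∀ {a b} x y → T⋆ a b x y ≡ true → TPoint a b x y
∈T⋆⇒TPoint 0                         0 _ = fixed ⟨0,0⟩
∈T⋆⇒TPoint 1                         0 _ = fixed ⟨1,0⟩
∈T⋆⇒TPoint 2                         0 _ = fixed ⟨2,0⟩
∈T⋆⇒TPoint 3                         0 ()
∈T⋆⇒TPoint (suc (suc (suc (suc m)))) 0 _ = row₀ m
∈T⋆⇒TPoint 0                         1 _ = fixed ⟨0,1⟩
∈T⋆⇒TPoint 1                         1 _ = fixed ⟨1,1⟩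
∈T⋆⇒TPoint 2                         1 _ = fixed ⟨2,1⟩
∈T⋆⇒TPoint 3                         1 _ = fixed ⟨3,1⟩
∈T⋆⇒TPoint (suc (suc (suc (suc m)))) 1 ()
∈T⋆⇒TPoint 0                         2 _ = fixed ⟨0,2⟩
∈T⋆⇒TPoint 1                         2 ()
∈T⋆⇒TPoint 2                         2 ()
∈T⋆⇒TPoint 3                         2 ()
∈T⋆⇒TPoint (suc (suc (suc (suc m)))) 2 _ = row₂ m
∈T⋆⇒TPoint {a} {b} x (suc (suc (suc y))) x,y∈T with Equivalence.to T-∨ (Equivalence.from T-≡ x,y∈T)
... | inj₁ on-diagonal with ≡ᵇ-∧ {x} {4 + a} {3 + y} {4 + a} on-diagonal
...   | refl , refl = diagonal
∈T⋆⇒TPoint {a} {b} x (suc (suc (suc y))) x,y∈T | inj₂ on-vertical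
  with ≡ᵇ-∧ {x} {1} {3 + y} {4 + b} on-vertical
...   | refl , refl = vertical

M₁⊆TPoint : ∀ {a b x y} → f⋆ x y ≡ true → TPoint a b x y
M₁⊆TPoint {x = 1} {1}           _ = fixed ⟨1,1⟩
M₁⊆TPoint {x = 2} {1}           _ = fixed ⟨2,1⟩
M₁⊆TPoint {x = 0}               ()
M₁⊆TPoint {x = 1} {0}           ()
M₁⊆TPoint {x = 1} {suc (suc _)} ()
M₁⊆TPoint {x = 2} {0}           ()
M₁⊆TPoint {x = 2} {suc (suc _)} ()
M₁⊆TPoint {x = suc (suc (suc _))} ()

diagonal∉T⋆ : ∀ {a a′ b} → a ≢ a′ → T⋆ a′ b (4 + a) (4 + a) ≡ false
diagonal∉T⋆ a≢a′ rewrite ≡ᵇ-≢ a≢a′ = refl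

vertical∉T⋆ : ∀ {a b b′} → b ≢ b′ → T⋆ a b′ 1 (4 + b) ≡ false
vertical∉T⋆ b≢b′ rewrite ≡ᵇ-≢ b≢b′ = refl

small : ∀ {n x} → 5 ≤ n → {_ : T (x <ᵇ 5)} → x < n
small {x = x} 5≤n {x<5} = ℕₚ.<-≤-trans (ℕₚ.<ᵇ⇒< x 5 x<5) 5≤n

row₂-combination : ∀ {n} x y → x < n → 2 ≤ n →
  ∃[ m ] ∃[ r ] ∃[ e ] (m < n × suc (suc y) · pt m 2 ≡ pt x (3 + y) ⊕ (r · pt 1 1 ⊕ e · pt 2 1))
row₂-combination {n} x y x<n 2≤n =
  m , r , e , m<n , subst (λ s → suc s · pt m 2 ≡ pt x (2 + s) ⊕ (r · pt 1 1 ⊕ e · pt 2 1)) r+e≡1+y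
                      (combination (subst (λ s → x + 2 * s ≡ r + m * suc s) (sym r+e≡1+y) division))
  where
  W m r : ℕ
  W = x + 2 * suc y
  m = W / suc (suc y)
  r = W % suc (suc y)
  division : W ≡ r + m * suc (suc y)
  division = m≡m%n+[m/n]*n W (suc (suc y))
  e : ℕ
  e = proj₁ (ℕₚ.m≤n⇒∃[o]m+o≡n (ℕₚ.≤-pred (m%n<n W (suc (suc y)))))
  r+e≡1+y : r + e ≡ suc y
  r+e≡1+y = proj₂ (ℕₚ.m≤n⇒∃[o]m+o≡n (ℕₚ.≤-pred (m%n<n W (suc (suc y)))))
  combination : x + 2 * (r + e) ≡ r + m * suc (r + e) →
                suc (r + e) · pt m 2 ≡ pt x (2 + (r + e)) ⊕ (r · pt 1 1 ⊕ e · pt 2 1)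
  combination eq = cong₂ _,_ xs (cong₂ _,_ (ys r e) (ws r e))
    where
    regroup : ∀ x r e → x + 2 * (r + e) ≡ r + (x + (r * 1 + e * 2))
    regroup = solve-∀
    xs : suc (r + e) * m ≡ x + (r * 1 + e * 2)
    xs = ℕₚ.+-cancelˡ-≡ r _ _ (begin
      r + suc (r + e) * m        ≡⟨ cong (r +_) (ℕₚ.*-comm (suc (r + e)) m) ⟩
      r + m * suc (r + e)        ≡⟨ sym eq ⟩
      x + 2 * (r + e)            ≡⟨ regroup x r e ⟩
      r + (x + (r * 1 + e * 2))  ∎)
      where open ≡-Reasoning
    ys : ∀ r e → suc (r + e) * 2 ≡ 2 + (r + e) + (r * 1 + e * 1)
    ys = solve-∀
    ws : ∀ r e → suc (r + e) * 1 ≡ 1 + (r * 1 + e * 1)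
    ws = solve-∀
  m<n : m < n
  m<n = ℕₚ.*-cancelʳ-< (suc (suc y)) m n (begin-strict
    m * suc (suc y)      ≤⟨ ℕₚ.m≤n+m _ r ⟩
    r + m * suc (suc y)  ≡⟨ sym division ⟩
    x + 2 * suc y        <⟨ ℕₚ.+-mono-<-≤ x<n (ℕₚ.*-monoˡ-≤ (suc y) 2≤n) ⟩
    n + n * suc y        ≡⟨ sym (ℕₚ.*-suc n (suc y)) ⟩
    n * suc (suc y)      ∎)
    where open ℕₚ.≤-Reasoning

module Oriented {n a b : ℕ} (5≤n : 5 ≤ n) (4+a<n : 4 + a < n) (4+b<n : 4 + b < n)
  (φ ψ : ℕ³ → ℚ)
  (φ-⊕ : ∀ u v → φ (u ⊕ v) ≡ φ u ℚ.+ φ v)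
  (ψ-⊕ : ∀ u v → ψ (u ⊕ v) ≡ ψ u ℚ.+ ψ v)
  (G₁₁ : φ (pt 1 1) ℚ.≤ 0ℚ × ψ (pt 1 1) ℚ.≤ 0ℚ)
  (G₂₁ : φ (pt 2 1) ℚ.≤ 0ℚ × ψ (pt 2 1) ℚ.≤ 0ℚ)
  (outside : ∀ {x y} → TPoint a b x y → f⋆ x y ≡ false → x < n → y < n →
             ¬ (φ (pt x y) ℚ.≤ 0ℚ × ψ (pt x y) ℚ.≤ 0ℚ))
  (φ-cuts-3,1 : 0ℚ ℚ.< φ (pt 3 1))
  where

  module Φ = AdditiveForm φ φ-⊕
  module Ψ = AdditiveForm ψ ψ-⊕

  G : ℕ³ → Set
  G v = φ v ℚ.≤ 0ℚ × ψ v ℚ.≤ 0ℚ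

  G-⊕ : ∀ {u v} → G u → G v → G (u ⊕ v)
  G-⊕ (φu , ψu) (φv , ψv) = Φ.nonPos-⊕ φu φv , Ψ.nonPos-⊕ ψu ψv

  G-· : ∀ k {v} → G v → G (k · v)
  G-· k (φv , ψv) = Φ.nonPos-· k φv , Ψ.nonPos-· k ψv

  G-·⁻¹ : ∀ k {v} → G (suc k · v) → G v
  G-·⁻¹ k (φkv , ψkv) = Φ.nonPos-·⁻¹ k φkv , Ψ.nonPos-·⁻¹ k ψkv

  excluded : ∀ {x y} → TPoint a b x y → f⋆ x y ≡ false → {_ : T (x <ᵇ 5)} {_ : T (y <ᵇ 5)} → ¬ G (pt x y)
  excluded t f≡false {x<5} {y<5} = outside t f≡false (small 5≤n {x<5}) (small 5≤n {y<5})

  ψ-cuts : ∀ {x y} → TPoint a b x y → f⋆ x y ≡ false → {_ : T (x <ᵇ 5)} {_ : T (y <ᵇ 5)} →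
           φ (pt x y) ℚ.≤ 0ℚ → 0ℚ ℚ.< ψ (pt x y)
  ψ-cuts t f≡false {x<5} {y<5} φ≤0 = ℚₚ.≰⇒> (λ ψ≤0 → excluded t f≡false {x<5} {y<5} (φ≤0 , ψ≤0))

  φ-cuts : ∀ {x y} → TPoint a b x y → f⋆ x y ≡ false → {_ : T (x <ᵇ 5)} {_ : T (y <ᵇ 5)} →
           ψ (pt x y) ℚ.≤ 0ℚ → 0ℚ ℚ.< φ (pt x y)
  φ-cuts t f≡false {x<5} {y<5} ψ≤0 = ℚₚ.≰⇒> (λ φ≤0 → excluded t f≡false {x<5} {y<5} (φ≤0 , ψ≤0))

  φ₁₁ : φ (pt 1 1) ℚ.≤ 0ℚ
  φ₁₁ = proj₁ G₁₁

  ψ₁₁ : ψ (pt 1 1) ℚ.≤ 0ℚ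
  ψ₁₁ = proj₂ G₁₁

  φ₂₁ : φ (pt 2 1) ℚ.≤ 0ℚ
  φ₂₁ = proj₁ G₂₁

  φ→ : 0ℚ ℚ.< φ (dir 1 0)
  φ→ = Φ.pos-cancel φ-cuts-3,1 φ₂₁

  ψ→ : ψ (dir 1 0) ℚ.≤ 0ℚ
  ψ→ = ℚₚ.<⇒≤ (Ψ.neg-cancel ψ₁₁ ψ₀₁)
    where
    ψ₀₁ : 0ℚ ℚ.< ψ (pt 0 1)
    ψ₀₁ = ψ-cuts (fixed ⟨0,1⟩) refl (ℚₚ.<⇒≤ (Φ.neg-cancel φ₁₁ φ→))

  not-3+k,1 : ∀ k → ¬ G (pt (3 + k) 1)
  not-3+k,1 k (φ≤0 , _) = ℚₚ.<-irrefl refl (ℚₚ.<-≤-trans 0<φ φ≤0)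
    where
    0<φ : 0ℚ ℚ.< φ (pt (3 + k) 1)
    0<φ = subst (λ v → 0ℚ ℚ.< φ v) (ray→ 3 1 k) (Φ.pos-⊕ φ-cuts-3,1 (Φ.nonNeg-· k (ℚₚ.<⇒≤ φ→)))

  not-3,0 : ¬ G (pt 3 0)
  not-3,0 (φ₃₀ , ψ₃₀) = excluded (fixed ⟨0,2⟩) refl (ℚₚ.<⇒≤ φ₀₂ , ℚₚ.<⇒≤ ψ₀₂)
    where
    ψ₂₀ : 0ℚ ℚ.< ψ (pt 2 0)
    ψ₂₀ = ψ-cuts (fixed ⟨2,0⟩) refl (ℚₚ.<⇒≤ (Φ.neg-cancel φ₃₀ φ→))
    φ₄₀ : 0ℚ ℚ.< φ (pt 4 0)
    φ₄₀ = φ-cuts (row₀ 0) refl (Ψ.nonPos-⊕ ψ₃₀ ψ→)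
    φ₀₂ : φ (pt 0 2) ℚ.< 0ℚ
    φ₀₂ = Φ.neg-cancel {pt 4 0} (Φ.nonPos-⊕ φ₂₁ φ₂₁) φ₄₀
    ψ₀₂ : ψ (pt 0 2) ℚ.< 0ℚ
    ψ₀₂ = Ψ.neg-cancel {pt 2 0} (Ψ.nonPos-⊕ ψ₁₁ ψ₁₁) ψ₂₀

  not-2,2 : ¬ G (pt 2 2)
  not-2,2 (φ₂₂ , ψ₂₂) = vertical-ray-or-not (Ψ.nonPos-or-pos (dir 0 1))
    where
    ψ₀₂ : 0ℚ ℚ.< ψ (pt 0 2)
    ψ₀₂ = ψ-cuts (fixed ⟨0,2⟩) refl (ℚₚ.<⇒≤ (Φ.neg-cancel φ₂₂ (Φ.pos-· 1 φ→)))
    φ₂₀ : 0ℚ ℚ.< φ (pt 2 0)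
    φ₂₀ = φ-cuts (fixed ⟨2,0⟩) refl (ℚₚ.<⇒≤ (Ψ.neg-cancel {pt 0 2} (Ψ.nonPos-⊕ ψ₁₁ ψ₁₁) ψ₀₂))
    φ↑ : φ (dir 0 1) ℚ.≤ 0ℚ
    φ↑ = Φ.nonPos-·⁻¹ 1 (ℚₚ.<⇒≤ (Φ.neg-cancel φ₂₂ φ₂₀))
    diagonal-ray-or-origin : 0ℚ ℚ.< ψ (dir 0 1) → ψ (dir 1 1) ℚ.≤ 0ℚ ⊎ 0ℚ ℚ.< ψ (dir 1 1) → ⊥
    diagonal-ray-or-origin ψ↑ (inj₁ ψ↗) = outside diagonal refl 4+a<n 4+a<n
      (subst G (ray↗ 2 2 (2 + a)) (G-⊕ (φ₂₂ , ψ₂₂) (G-· (2 + a) (ℚₚ.<⇒≤ φ↗ , ψ↗))))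
      where
      φ₁₀ : 0ℚ ℚ.< φ (pt 1 0)
      φ₁₀ = φ-cuts (fixed ⟨1,0⟩) refl (ℚₚ.<⇒≤ (Ψ.neg-cancel ψ₁₁ ψ↑))
      φ↗ : φ (dir 1 1) ℚ.< 0ℚ
      φ↗ = Φ.neg-cancel φ₂₁ φ₁₀
    diagonal-ray-or-origin ψ↑ (inj₂ ψ↗) = excluded (fixed ⟨0,0⟩) refl (ℚₚ.<⇒≤ φ₀₀ , ℚₚ.<⇒≤ ψ₀₀)
      where
      φ₄₂ : 0ℚ ℚ.< φ (pt 4 2)
      φ₄₂ = φ-cuts (row₂ 0) refl (Ψ.nonPos-⊕ ψ₂₂ (Ψ.nonPos-· 2 ψ→))
      φ₀₀ : φ (pt 0 0) ℚ.< 0ℚ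
      φ₀₀ = Φ.neg-cancel {pt 4 2} (Φ.nonPos-⊕ φ₂₁ φ₂₁) φ₄₂
      ψ₀₀ : ψ (pt 0 0) ℚ.< 0ℚ
      ψ₀₀ = Ψ.neg-cancel ψ₁₁ ψ↗
    vertical-ray-or-not : ψ (dir 0 1) ℚ.≤ 0ℚ ⊎ 0ℚ ℚ.< ψ (dir 0 1) → ⊥
    vertical-ray-or-not (inj₁ ψ↑) = outside vertical refl (small 5≤n) 4+b<n
      (subst G (ray↑ 1 1 (3 + b)) (G-⊕ G₁₁ (G-· (3 + b) (φ↑ , ψ↑))))
    vertical-ray-or-not (inj₂ ψ↑) = diagonal-ray-or-origin ψ↑ (Ψ.nonPos-or-pos (dir 1 1))

  not-1,2 : ¬ G (pt 1 2)
  not-1,2 (φ₁₂ , ψ₁₂) with Φ.nonPos-or-pos (pt 2 2)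
  ... | inj₁ φ₂₂ = not-2,2 (φ₂₂ , Ψ.nonPos-⊕ ψ₁₂ ψ→)
  ... | inj₂ φ₂₂ = excluded (fixed ⟨2,0⟩) refl (ℚₚ.<⇒≤ φ₂₀ , ℚₚ.<⇒≤ ψ₂₀)
    where
    ψ₀₂ : 0ℚ ℚ.< ψ (pt 0 2)
    ψ₀₂ = ψ-cuts (fixed ⟨0,2⟩) refl (ℚₚ.<⇒≤ (Φ.neg-cancel φ₁₂ φ→))
    φ₂₀ : φ (pt 2 0) ℚ.< 0ℚ
    φ₂₀ = Φ.neg-cancel {pt 2 2} (Φ.nonPos-⊕ φ₂₁ φ₂₁) φ₂₂
    ψ₂₀ : ψ (pt 2 0) ℚ.< 0ℚ
    ψ₂₀ = Ψ.neg-cancel {pt 0 2} (Ψ.nonPos-⊕ ψ₁₁ ψ₁₁) ψ₀₂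

  not-3,2 : ¬ G (pt 3 2)
  not-3,2 (φ₃₂ , ψ₃₂) with Ψ.nonPos-or-pos (pt 2 2)
  ... | inj₁ ψ₂₂ = not-2,2 (ℚₚ.<⇒≤ (Φ.neg-cancel φ₃₂ φ→) , ψ₂₂)
  ... | inj₂ ψ₂₂ = excluded (fixed ⟨0,0⟩) refl (ℚₚ.<⇒≤ φ₀₀ , ℚₚ.<⇒≤ ψ₀₀)
    where
    φ₄₂ : 0ℚ ℚ.< φ (pt 4 2)
    φ₄₂ = φ-cuts (row₂ 0) refl (Ψ.nonPos-⊕ ψ₃₂ ψ→)
    φ₀₀ : φ (pt 0 0) ℚ.< 0ℚ
    φ₀₀ = Φ.neg-cancel {pt 4 2} (Φ.nonPos-⊕ φ₂₁ φ₂₁) φ₄₂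
    ψ₀₀ : ψ (pt 0 0) ℚ.< 0ℚ
    ψ₀₀ = Ψ.neg-cancel {pt 2 2} (Ψ.nonPos-⊕ ψ₁₁ ψ₁₁) ψ₂₂

  not-row₂ : ∀ {x} → x < n → ¬ G (pt x 2)
  not-row₂ {0}                       _   = excluded (fixed ⟨0,2⟩) refl
  not-row₂ {1}                       _   = not-1,2
  not-row₂ {2}                       _   = not-2,2
  not-row₂ {3}                       _   = not-3,2
  not-row₂ {suc (suc (suc (suc m)))} x<n = outside (row₂ m) refl x<n (small 5≤n)

  not-above-row₂ : ∀ {x y} → x < n → ¬ G (pt x (3 + y))
  not-above-row₂ {x} {y} x<n g with row₂-combination x y x<n (ℕₚ.≤-trans (s≤s (s≤s z≤n)) 5≤n)
  ... | m , r , e , m<n , combination = not-row₂ m<n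
    (G-·⁻¹ (suc y) (subst G (sym combination) (G-⊕ g (G-⊕ (G-· r G₁₁) (G-· e G₂₁)))))

  only-M₁ : ∀ {x y} → x < n → y < n → f⋆ x y ≡ false → ¬ G (pt x y)
  only-M₁ {0}                       {0}                 x<n y<n _ = outside (fixed ⟨0,0⟩) refl x<n y<n
  only-M₁ {1}                       {0}                 x<n y<n _ = outside (fixed ⟨1,0⟩) refl x<n y<n
  only-M₁ {2}                       {0}                 x<n y<n _ = outside (fixed ⟨2,0⟩) refl x<n y<n
  only-M₁ {3}                       {0}                 _   _   _ = not-3,0
  only-M₁ {suc (suc (suc (suc m)))} {0}                 x<n y<n _ = outside (row₀ m) refl x<n y<n
  only-M₁ {0}                       {1}                 x<n y<n _ = outside (fixed ⟨0,1⟩) refl x<n y<n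
  only-M₁ {suc (suc (suc k))}       {1}                 _   _   _ = not-3+k,1 k
  only-M₁ {x}                       {2}                 x<n _   _ = not-row₂ x<n
  only-M₁ {x}                       {suc (suc (suc y))} x<n _   _ = not-above-row₂ x<n

module Teaching {n a b : ℕ} (5≤n : 5 ≤ n) (4+a<n : 4 + a < n) (4+b<n : 4 + b < n)
  (φ ψ : ℕ³ → ℚ)
  (φ-⊕ : ∀ u v → φ (u ⊕ v) ≡ φ u ℚ.+ φ v)
  (ψ-⊕ : ∀ u v → ψ (u ⊕ v) ≡ ψ u ℚ.+ ψ v)
  (G₁₁ : φ (pt 1 1) ℚ.≤ 0ℚ × ψ (pt 1 1) ℚ.≤ 0ℚ)
  (G₂₁ : φ (pt 2 1) ℚ.≤ 0ℚ × ψ (pt 2 1) ℚ.≤ 0ℚ)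
  (outside : ∀ {x y} → TPoint a b x y → f⋆ x y ≡ false → x < n → y < n →
             ¬ (φ (pt x y) ℚ.≤ 0ℚ × ψ (pt x y) ℚ.≤ 0ℚ))
  where

  only-M₁ : ∀ {x y} → x < n → y < n → f⋆ x y ≡ false → ¬ (φ (pt x y) ℚ.≤ 0ℚ × ψ (pt x y) ℚ.≤ 0ℚ)
  only-M₁ with AdditiveForm.nonPos-or-pos φ φ-⊕ (pt 3 1)
  ... | inj₂ φ-cuts = Oriented.only-M₁ 5≤n 4+a<n 4+b<n φ ψ φ-⊕ ψ-⊕ G₁₁ G₂₁ outside φ-cuts
  ... | inj₁ φ₃₁ = λ x<n y<n f≡false →
    Oriented.only-M₁ 5≤n 4+a<n 4+b<n ψ φ ψ-⊕ φ-⊕ (swap G₁₁) (swap G₂₁)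
      (λ t f≡false x<n y<n → outside t f≡false x<n y<n ∘ swap) ψ-cuts x<n y<n f≡false ∘ swap
    where
    ψ-cuts : 0ℚ ℚ.< ψ (pt 3 1)
    ψ-cuts = ℚₚ.≰⇒> (λ ψ₃₁ → outside (fixed ⟨3,1⟩) refl (small 5≤n) (small 5≤n) (φ₃₁ , ψ₃₁))

teaches : ∀ {n a b} → 5 ≤ n → 4 + a < n → 4 + b < n → IsTeachingSet n (onGrid f⋆) (onGrid (T⋆ a b))
teaches {n} {a} {b} 5≤n 4+a<n 4+b<n g (h₁ , h₂ , g⇔) g≈f = agrees-everywhere
  where
  G : ℕ → ℕ → Set
  G x y = form h₁ (pt x y) ℚ.≤ 0ℚ × form h₂ (pt x y) ℚ.≤ 0ℚ

  g⇔G : ∀ i j → g (i , j) ≡ true ⇔ G (toℕ i) (toℕ j)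
  g⇔G i j = ⇔.trans (g⇔ (i , j)) (inHalfPlane⇔ h₁ i j ×-⇔ inHalfPlane⇔ h₂ i j)

  at : ∀ {x y} → x < n → y < n → Point n
  at x<n y<n = fromℕ< x<n , fromℕ< y<n

  g-at⇔G : ∀ {x y} (x<n : x < n) (y<n : y < n) → g (at x<n y<n) ≡ true ⇔ G x y
  g-at⇔G x<n y<n = subst₂ (λ x′ y′ → g (at x<n y<n) ≡ true ⇔ G x′ y′)
                          (toℕ-fromℕ< x<n) (toℕ-fromℕ< y<n) (g⇔G (fromℕ< x<n) (fromℕ< y<n))

  g≡f⋆-on-T : ∀ {x y} → TPoint a b x y → (x<n : x < n) (y<n : y < n) → g (at x<n y<n) ≡ f⋆ x y
  g≡f⋆-on-T t x<n y<n = trans (g≈f (at x<n y<n) (trans (onGrid-at (T⋆ a b)) (TPoint⇒∈T⋆ t))) (onGrid-at f⋆)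
    where
    onGrid-at : ∀ h → onGrid h (at x<n y<n) ≡ h _ _
    onGrid-at h = cong₂ h (toℕ-fromℕ< x<n) (toℕ-fromℕ< y<n)

  inside : ∀ {x y} → Fixed x y → f⋆ x y ≡ true → x < n → y < n → G x y
  inside p f≡true x<n y<n = Equivalence.to (g-at⇔G x<n y<n) (trans (g≡f⋆-on-T (fixed p) x<n y<n) f≡true)

  outside : ∀ {x y} → TPoint a b x y → f⋆ x y ≡ false → x < n → y < n → ¬ G x y
  outside t f≡false x<n y<n Gxy =
    true≢false (trans (sym (Equivalence.from (g-at⇔G x<n y<n) Gxy)) (trans (g≡f⋆-on-T t x<n y<n) f≡false))

  open Teaching 5≤n 4+a<n 4+b<n (form h₁) (form h₂) (form-⊕ h₁) (form-⊕ h₂)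
    (inside ⟨1,1⟩ refl (small 5≤n) (small 5≤n)) (inside ⟨2,1⟩ refl (small 5≤n) (small 5≤n)) outside

  agrees-everywhere : ∀ z → g z ≡ onGrid f⋆ z
  agrees-everywhere (i , j) with f⋆ (toℕ i) (toℕ j) in f≡
  ... | true  = trans (g≈f (i , j) (TPoint⇒∈T⋆ {a} {b} (M₁⊆TPoint f≡))) f≡
  ... | false = ¬-not (only-M₁ (toℕ<n i) (toℕ<n j) f≡ ∘ Equivalence.to (g⇔G i j))

record Affine : Set where
  constructor affine
  field c₀ c₁ c₂ : ℕ

-- x ⊛ c = x * c, but recursing on x and with c = 0 short-circuited: half-planes with literal
-- coefficients then evaluate to booleans by computation even at the points (4 + m, 0),
-- (4 + m, 2), (4 + a, 4 + a) and (1, 4 + b) of T⋆ with symbolic m, a, b.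
infixl 7 _⊛_
_⊛_ : ℕ → ℕ → ℕ
x ⊛ zero  = zero
x ⊛ suc c = x * suc c

⊛≗* : ∀ x c → x ⊛ c ≡ x * c
⊛≗* x zero    = sym (ℕₚ.*-zeroʳ x)
⊛≗* x (suc c) = refl

⟦_⟧ : Affine → ℕ → ℕ → ℕ
⟦ affine c₀ c₁ c₂ ⟧ x y = c₀ + x ⊛ c₁ + y ⊛ c₂

eval : Affine → ℕ → ℕ → ℕ
eval (affine c₀ c₁ c₂) x y = c₀ + c₁ * x + c₂ * y

⟦⟧≡eval : ∀ A x y → ⟦ A ⟧ x y ≡ eval A x y
⟦⟧≡eval (affine c₀ c₁ c₂) x y =
  cong₂ (λ u v → c₀ + u + v) (trans (⊛≗* x c₁) (ℕₚ.*-comm x c₁))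
                             (trans (⊛≗* y c₂) (ℕₚ.*-comm y c₂))

infix 4 _≼_
record Ineq : Set where
  constructor _≼_
  field lhs rhs : Affine

Holds : Ineq → ℕ → ℕ → Set
Holds (A ≼ B) x y = eval A x y ≤ eval B x y

holdsᵇ : Ineq → ℕ → ℕ → Bool
holdsᵇ (A ≼ B) x y = ⟦ A ⟧ x y ≤ᵇ ⟦ B ⟧ x y

holdsᵇ⇔Holds : ∀ I x y → holdsᵇ I x y ≡ true ⇔ Holds I x y
holdsᵇ⇔Holds (A ≼ B) x y =
  subst₂ (λ l r → (⟦ A ⟧ x y ≤ᵇ ⟦ B ⟧ x y) ≡ true ⇔ l ≤ r) (⟦⟧≡eval A x y) (⟦⟧≡eval B x y)
         (⇔.trans (⇔.sym T-≡) (mk⇔ (ℕₚ.≤ᵇ⇒≤ _ _) ℕₚ.≤⇒≤ᵇ))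

region : Ineq → Ineq → ℕ → ℕ → Bool
region I J x y = holdsᵇ I x y ∧ holdsᵇ J x y

coefficients : Ineq → ℚ × ℚ × ℚ
coefficients (affine a₀ a₁ a₂ ≼ affine b₀ b₁ b₂) =
  (ι b₀ ℚ.- ι a₀ , ι a₁ ℚ.- ι b₁ , ι a₂ ℚ.- ι b₂)

ι-eval : ∀ c₀ c₁ c₂ x y → ι (eval (affine c₀ c₁ c₂) x y) ≡ ι c₀ ℚ.+ ι c₁ ℚ.* ι x ℚ.+ ι c₂ ℚ.* ι y
ι-eval c₀ c₁ c₂ x y
  rewrite ι-+ (c₀ + c₁ * x) (c₂ * y) | ι-+ c₀ (c₁ * x) | ι-* c₁ x | ι-* c₂ y = refl

form-coefficients : ∀ I x y →
  form (coefficients I) (pt x y) ≡ ι (eval (Ineq.lhs I) x y) ℚ.- ι (eval (Ineq.rhs I) x y)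
form-coefficients (affine a₀ a₁ a₂ ≼ affine b₀ b₁ b₂) x y
  rewrite ι-eval a₀ a₁ a₂ x y | ι-eval b₀ b₁ b₂ x y | ι-1 =
  rearrange (ι a₀) (ι a₁) (ι a₂) (ι b₀) (ι b₁) (ι b₂) (ι x) (ι y)
  where
  open +-*-Solver
  rearrange : ∀ a₀ a₁ a₂ b₀ b₁ b₂ x y →
    (a₁ ℚ.- b₁) ℚ.* x ℚ.+ (a₂ ℚ.- b₂) ℚ.* y ℚ.- (b₀ ℚ.- a₀) ℚ.* 1ℚ ≡
    (a₀ ℚ.+ a₁ ℚ.* x ℚ.+ a₂ ℚ.* y) ℚ.- (b₀ ℚ.+ b₁ ℚ.* x ℚ.+ b₂ ℚ.* y)
  rearrange = solve 8 (λ a₀ a₁ a₂ b₀ b₁ b₂ x y →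
    (a₁ :- b₁) :* x :+ (a₂ :- b₂) :* y :- (b₀ :- a₀) :* con 1ℚ :=
    (a₀ :+ a₁ :* x :+ a₂ :* y) :- (b₀ :+ b₁ :* x :+ b₂ :* y)) refl

holdsᵇ⇔inHalfPlane : ∀ I {n} (i j : Fin n) →
  holdsᵇ I (toℕ i) (toℕ j) ≡ true ⇔ InHalfPlane (coefficients I) (i , j)
holdsᵇ⇔inHalfPlane I@(A ≼ B) i j =
  ⇔.trans (holdsᵇ⇔Holds I (toℕ i) (toℕ j)) (⇔.trans (mk⇔ ι-mono-≤ ι-cancel-≤) (⇔.trans ≤⇔-≤0
    (subst (λ q → q ℚ.≤ 0ℚ ⇔ InHalfPlane (coefficients I) (i , j)) (form-coefficients I (toℕ i) (toℕ j))
           (⇔.sym (inHalfPlane⇔ (coefficients I) i j)))))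

∧≡true⇔ : ∀ {p q} → p ∧ q ≡ true ⇔ (p ≡ true × q ≡ true)
∧≡true⇔ = ⇔.trans (⇔.sym T-≡) (⇔.trans T-∧ (T-≡ ×-⇔ T-≡))

region∈𝔗 : ∀ {n} I J → InT n (onGrid (region I J))
region∈𝔗 I J = coefficients I , coefficients J ,
  λ (i , j) → ⇔.trans ∧≡true⇔ (holdsᵇ⇔inHalfPlane I i j ×-⇔ holdsᵇ⇔inHalfPlane J i j)

module Region (H₁ H₂ : Ineq) where

  in-region⇔ : ∀ x y → region H₁ H₂ x y ≡ true ⇔ (Holds H₁ x y × Holds H₂ x y)
  in-region⇔ x y = ⇔.trans ∧≡true⇔ (holdsᵇ⇔Holds H₁ x y ×-⇔ holdsᵇ⇔Holds H₂ x y)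

  in-region : ∀ x y → Holds H₁ x y → Holds H₂ x y → region H₁ H₂ x y ≡ true
  in-region x y h₁ h₂ = Equivalence.from (in-region⇔ x y) (h₁ , h₂)

  violates₁ : ∀ x y → ¬ Holds H₁ x y → region H₁ H₂ x y ≡ false
  violates₁ x y ¬h₁ rewrite ¬-not (¬h₁ ∘ Equivalence.to (holdsᵇ⇔Holds H₁ x y)) = refl

  violates₂ : ∀ x y → ¬ Holds H₂ x y → region H₁ H₂ x y ≡ false
  violates₂ x y ¬h₂ rewrite ¬-not (¬h₂ ∘ Equivalence.to (holdsᵇ⇔Holds H₂ x y)) = ∧-zeroʳ _

Agrees : ℕ → ℕ → ℕ → ℕ → ℕ → (ℕ → ℕ → Bool) → Set
Agrees n a b x₀ y₀ g = ∀ {x y} → TPoint a b x y → x < n → ¬ (x ≡ x₀ × y ≡ y₀) → g x y ≡ f⋆ x y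

record Witness (n a b x₀ y₀ : ℕ) : Set where
  constructor witness
  field
    H₁ H₂  : Ineq
    flips  : region H₁ H₂ x₀ y₀ ≡ not (f⋆ x₀ y₀)
    agrees : Agrees n a b x₀ y₀ (region H₁ H₂)

<-by : ∀ {m n} k → suc m + k ≡ n → m < n
<-by {m} k eq = subst (suc m ≤_) eq (ℕₚ.m≤m+n (suc m) k)

≤-by : ∀ {m n} k → m + k ≡ n → m ≤ n
≤-by {m} k eq = subst (m ≤_) eq (ℕₚ.m≤m+n m k)

2y≤1+x-fails-on-diagonal : ∀ a → ¬ Holds (affine 0 0 2 ≼ affine 1 1 0) (4 + a) (4 + a)
2y≤1+x-fails-on-diagonal a = ℕₚ.<⇒≱ (<-by (2 + a) (slack a))
  where
  slack : ∀ a → suc (1 + 1 * (4 + a) + 0 * (4 + a)) + (2 + a) ≡ 0 + 0 * (4 + a) + 2 * (4 + a)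
  slack = solve-∀

2x≤3+y-fails-on-diagonal : ∀ a → ¬ Holds (affine 0 2 0 ≼ affine 3 0 1) (4 + a) (4 + a)
2x≤3+y-fails-on-diagonal a = ℕₚ.<⇒≱ (<-by a (slack a))
  where
  slack : ∀ a → suc (3 + 0 * (4 + a) + 1 * (4 + a)) + a ≡ 0 + 2 * (4 + a) + 0 * (4 + a)
  slack = solve-∀

module _ {n a b : ℕ} where

  w₁₁ : Witness n a b 1 1
  w₁₁ = witness H₁ H₂ refl agrees
    where
    H₁ H₂ : Ineq
    H₁ = affine 3 0 0 ≼ affine 0 1 1
    H₂ = affine 0 1 1 ≼ affine 3 0 0
    agrees : Agrees n a b 1 1 (region H₁ H₂)
    agrees (fixed ⟨0,0⟩) _ _  = refl
    agrees (fixed ⟨1,0⟩) _ _  = refl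
    agrees (fixed ⟨2,0⟩) _ _  = refl
    agrees (fixed ⟨0,1⟩) _ _  = refl
    agrees (fixed ⟨1,1⟩) _ ≢t = ⊥-elim (≢t (refl , refl))
    agrees (fixed ⟨2,1⟩) _ _  = refl
    agrees (fixed ⟨3,1⟩) _ _  = refl
    agrees (fixed ⟨0,2⟩) _ _  = refl
    agrees (row₀ m)      _ _  = refl
    agrees (row₂ m)      _ _  = refl
    agrees diagonal      _ _  = refl
    agrees vertical      _ _  = refl

  w₂₁ : Witness n a b 2 1
  w₂₁ = witness H₁ H₂ refl agrees
    where
    H₁ H₂ : Ineq
    H₁ = affine 3 0 0 ≼ affine 0 2 1
    H₂ = affine 0 2 1 ≼ affine 3 0 0
    agrees : Agrees n a b 2 1 (region H₁ H₂)
    agrees (fixed ⟨0,0⟩) _ _  = refl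
    agrees (fixed ⟨1,0⟩) _ _  = refl
    agrees (fixed ⟨2,0⟩) _ _  = refl
    agrees (fixed ⟨0,1⟩) _ _  = refl
    agrees (fixed ⟨1,1⟩) _ _  = refl
    agrees (fixed ⟨2,1⟩) _ ≢t = ⊥-elim (≢t (refl , refl))
    agrees (fixed ⟨3,1⟩) _ _  = refl
    agrees (fixed ⟨0,2⟩) _ _  = refl
    agrees (row₀ m)      _ _  = refl
    agrees (row₂ m)      _ _  = refl
    agrees diagonal      _ _  = refl
    agrees vertical      _ _  = refl

  w₀₀ : Witness n a b 0 0
  w₀₀ = witness H₁ H₂ refl agrees
    where
    H₁ H₂ : Ineq
    H₁ = affine 0 0 2 ≼ affine 1 1 0
    H₂ = affine 0 2 0 ≼ affine 1 0 3
    open Region H₁ H₂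
    agrees : Agrees n a b 0 0 (region H₁ H₂)
    agrees (fixed ⟨0,0⟩) _ ≢t = ⊥-elim (≢t (refl , refl))
    agrees (fixed ⟨1,0⟩) _ _  = refl
    agrees (fixed ⟨2,0⟩) _ _  = refl
    agrees (fixed ⟨0,1⟩) _ _  = refl
    agrees (fixed ⟨1,1⟩) _ _  = refl
    agrees (fixed ⟨2,1⟩) _ _  = refl
    agrees (fixed ⟨3,1⟩) _ _  = refl
    agrees (fixed ⟨0,2⟩) _ _  = refl
    agrees (row₀ m)      _ _  = refl
    agrees (row₂ m)      _ _  = refl
    agrees diagonal      _ _  = violates₁ (4 + a) (4 + a) (2y≤1+x-fails-on-diagonal a)
    agrees vertical      _ _  = refl

  w₁₀ : Witness n a b 1 0
  w₁₀ = witness H₁ H₂ refl agrees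
    where
    H₁ H₂ : Ineq
    H₁ = affine 1 0 1 ≼ affine 0 2 0
    H₂ = affine 0 2 0 ≼ affine 3 0 1
    open Region H₁ H₂
    agrees : Agrees n a b 1 0 (region H₁ H₂)
    agrees (fixed ⟨0,0⟩) _ _  = refl
    agrees (fixed ⟨1,0⟩) _ ≢t = ⊥-elim (≢t (refl , refl))
    agrees (fixed ⟨2,0⟩) _ _  = refl
    agrees (fixed ⟨0,1⟩) _ _  = refl
    agrees (fixed ⟨1,1⟩) _ _  = refl
    agrees (fixed ⟨2,1⟩) _ _  = refl
    agrees (fixed ⟨3,1⟩) _ _  = refl
    agrees (fixed ⟨0,2⟩) _ _  = refl
    agrees (row₀ m)      _ _  = refl
    agrees (row₂ m)      _ _  = refl
    agrees diagonal      _ _  = violates₂ (4 + a) (4 + a) (2x≤3+y-fails-on-diagonal a)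
    agrees vertical      _ _  = refl

  w₂₀ : Witness n a b 2 0
  w₂₀ = witness H₁ H₂ refl agrees
    where
    H₁ H₂ : Ineq
    H₁ = affine 3 0 0 ≼ affine 0 2 1
    H₂ = affine 0 1 1 ≼ affine 3 0 0
    agrees : Agrees n a b 2 0 (region H₁ H₂)
    agrees (fixed ⟨0,0⟩) _ _  = refl
    agrees (fixed ⟨1,0⟩) _ _  = refl
    agrees (fixed ⟨2,0⟩) _ ≢t = ⊥-elim (≢t (refl , refl))
    agrees (fixed ⟨0,1⟩) _ _  = refl
    agrees (fixed ⟨1,1⟩) _ _  = refl
    agrees (fixed ⟨2,1⟩) _ _  = refl
    agrees (fixed ⟨3,1⟩) _ _  = refl
    agrees (fixed ⟨0,2⟩) _ _  = refl
    agrees (row₀ m)      _ _  = refl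
    agrees (row₂ m)      _ _  = refl
    agrees diagonal      _ _  = refl
    agrees vertical      _ _  = refl

  w₀₁ : Witness n a b 0 1
  w₀₁ = witness H₁ H₂ refl agrees
    where
    H₁ H₂ : Ineq
    H₁ = affine 0 0 1 ≼ affine 1 0 0
    H₂ = affine 1 1 0 ≼ affine 0 0 3
    agrees : Agrees n a b 0 1 (region H₁ H₂)
    agrees (fixed ⟨0,0⟩) _ _  = refl
    agrees (fixed ⟨1,0⟩) _ _  = refl
    agrees (fixed ⟨2,0⟩) _ _  = refl
    agrees (fixed ⟨0,1⟩) _ ≢t = ⊥-elim (≢t (refl , refl))
    agrees (fixed ⟨1,1⟩) _ _  = refl
    agrees (fixed ⟨2,1⟩) _ _  = refl
    agrees (fixed ⟨3,1⟩) _ _  = refl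
    agrees (fixed ⟨0,2⟩) _ _  = refl
    agrees (row₀ m)      _ _  = refl
    agrees (row₂ m)      _ _  = refl
    agrees diagonal      _ _  = refl
    agrees vertical      _ _  = refl

  w₀₂ : Witness n a b 0 2
  w₀₂ = witness H₁ H₂ refl agrees
    where
    H₁ H₂ : Ineq
    H₁ = affine 3 0 0 ≼ affine 0 1 2
    H₂ = affine 0 1 1 ≼ affine 3 0 0
    agrees : Agrees n a b 0 2 (region H₁ H₂)
    agrees (fixed ⟨0,0⟩) _ _  = refl
    agrees (fixed ⟨1,0⟩) _ _  = refl
    agrees (fixed ⟨2,0⟩) _ _  = refl
    agrees (fixed ⟨0,1⟩) _ _  = refl
    agrees (fixed ⟨1,1⟩) _ _  = refl
    agrees (fixed ⟨2,1⟩) _ _  = refl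
    agrees (fixed ⟨3,1⟩) _ _  = refl
    agrees (fixed ⟨0,2⟩) _ ≢t = ⊥-elim (≢t (refl , refl))
    agrees (row₀ m)      _ _  = refl
    agrees (row₂ m)      _ _  = refl
    agrees diagonal      _ _  = refl
    agrees vertical      _ _  = refl

  w-diagonal : Witness n a b (4 + a) (4 + a)
  w-diagonal =
    witness H₁ H₂ (in-region (4 + a) (4 + a) (≤-by (3 + a) (slack₁ a)) (≤-by (5 + a) (slack₂ a))) agrees
    where
    H₁ H₂ : Ineq
    H₁ = affine 1 0 1 ≼ affine 0 2 0
    H₂ = affine 0 2 0 ≼ affine 1 0 3
    open Region H₁ H₂
    slack₁ : ∀ a → 1 + 0 * (4 + a) + 1 * (4 + a) + (3 + a) ≡ 0 + 2 * (4 + a) + 0 * (4 + a)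
    slack₁ = solve-∀
    slack₂ : ∀ a → 0 + 2 * (4 + a) + 0 * (4 + a) + (5 + a) ≡ 1 + 0 * (4 + a) + 3 * (4 + a)
    slack₂ = solve-∀
    agrees : Agrees n a b (4 + a) (4 + a) (region H₁ H₂)
    agrees (fixed ⟨0,0⟩) _ _  = refl
    agrees (fixed ⟨1,0⟩) _ _  = refl
    agrees (fixed ⟨2,0⟩) _ _  = refl
    agrees (fixed ⟨0,1⟩) _ _  = refl
    agrees (fixed ⟨1,1⟩) _ _  = refl
    agrees (fixed ⟨2,1⟩) _ _  = refl
    agrees (fixed ⟨3,1⟩) _ _  = refl
    agrees (fixed ⟨0,2⟩) _ _  = refl
    agrees (row₀ m)      _ _  = refl
    agrees (row₂ m)      _ _  = refl
    agrees diagonal      _ ≢t = ⊥-elim (≢t (refl , refl))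
    agrees vertical      _ _  = refl

  w-vertical : Witness n a b 1 (4 + b)
  w-vertical = witness H₁ H₂ refl agrees
    where
    H₁ H₂ : Ineq
    H₁ = affine 3 0 0 ≼ affine 0 2 1
    H₂ = affine 0 2 0 ≼ affine 3 0 1
    open Region H₁ H₂
    agrees : Agrees n a b 1 (4 + b) (region H₁ H₂)
    agrees (fixed ⟨0,0⟩) _ _  = refl
    agrees (fixed ⟨1,0⟩) _ _  = refl
    agrees (fixed ⟨2,0⟩) _ _  = refl
    agrees (fixed ⟨0,1⟩) _ _  = refl
    agrees (fixed ⟨1,1⟩) _ _  = refl
    agrees (fixed ⟨2,1⟩) _ _  = refl
    agrees (fixed ⟨3,1⟩) _ _  = refl
    agrees (fixed ⟨0,2⟩) _ _  = refl
    agrees (row₀ m)      _ _  = refl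
    agrees (row₂ m)      _ _  = refl
    agrees diagonal      _ _  = violates₂ (4 + a) (4 + a) (2x≤3+y-fails-on-diagonal a)
    agrees vertical      _ ≢t = ⊥-elim (≢t (refl , refl))

eval-const : ∀ c x y → eval (affine c 0 0) x y ≡ c
eval-const c x y = trans (ℕₚ.+-identityʳ (c + 0)) (ℕₚ.+-identityʳ c)

module Strip (ℓ : Affine) (lo hi : ℕ) where

  H₁ H₂ : Ineq
  H₁ = affine lo 0 0 ≼ ℓ
  H₂ = ℓ ≼ affine hi 0 0

  open Region H₁ H₂

  below : ∀ x y → eval ℓ x y < lo → region H₁ H₂ x y ≡ false
  below x y ℓ<lo = violates₁ x y (ℕₚ.<⇒≱ ℓ<lo ∘ subst (_≤ eval ℓ x y) (eval-const lo x y))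

  above : ∀ x y → hi < eval ℓ x y → region H₁ H₂ x y ≡ false
  above x y hi<ℓ = violates₂ x y (ℕₚ.<⇒≱ hi<ℓ ∘ subst (eval ℓ x y ≤_) (eval-const hi x y))

  inside : ∀ x y → lo ≤ eval ℓ x y → eval ℓ x y ≤ hi → region H₁ H₂ x y ≡ true
  inside x y lo≤ℓ ℓ≤hi = in-region x y (subst (_≤ eval ℓ x y) (sym (eval-const lo x y)) lo≤ℓ)
                                       (subst (eval ℓ x y ≤_) (sym (eval-const hi x y)) ℓ≤hi)

module Window (M : ℕ) where

  below-window : ∀ {x} → x < 4 + M → 2 * x < 7 + 2 * M
  below-window {x} x<4+M = ℕₚ.≤-<-trans (ℕₚ.*-monoʳ-≤ 2 (ℕₚ.≤-pred x<4+M)) (<-by 0 (slack M))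
    where
    slack : ∀ M → suc (2 * (3 + M)) + 0 ≡ 7 + 2 * M
    slack = solve-∀

  above-window : ∀ {x} → 4 + M < x → 9 + 2 * M < 2 * x
  above-window {x} 4+M<x = ℕₚ.<-≤-trans (<-by 0 (slack M)) (ℕₚ.*-monoʳ-≤ 2 4+M<x)
    where
    slack : ∀ M → suc (9 + 2 * M) + 0 ≡ 2 * (5 + M)
    slack = solve-∀

  in-window : 7 + 2 * M ≤ 2 * (4 + M) × 2 * (4 + M) ≤ 9 + 2 * M
  in-window = ≤-by 1 (lower M) , ≤-by 1 (upper M)
    where
    lower : ∀ M → 7 + 2 * M + 1 ≡ 2 * (4 + M)
    lower = solve-∀
    upper : ∀ M → 2 * (4 + M) + 1 ≡ 9 + 2 * M
    upper = solve-∀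

-- On the grid, x + n y enumerates the points row by row, so the strip n + 1 ≤ x + n y ≤ n + 3
-- is exactly {(1,1), (2,1), (3,1)}.
module Witness⟨3,1⟩ {n a b : ℕ} (4≤n : 4 ≤ n) where

  open Strip (affine 0 1 n) (suc n) (3 + n)

  value₀ : ∀ x → eval (affine 0 1 n) x 0 ≡ x
  value₀ x = lemma n x
    where
    lemma : ∀ n x → 0 + 1 * x + n * 0 ≡ x
    lemma = solve-∀

  value₁ : ∀ x → eval (affine 0 1 n) x 1 ≡ x + n
  value₁ x = lemma n x
    where
    lemma : ∀ n x → 0 + 1 * x + n * 1 ≡ x + n
    lemma = solve-∀

  value₂₊ : ∀ x y → eval (affine 0 1 n) x (2 + y) ≡ n + n + (x + y * n)
  value₂₊ x y = lemma n x y
    where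
    lemma : ∀ n x y → 0 + 1 * x + n * (2 + y) ≡ n + n + (x + y * n)
    lemma = solve-∀

  on-row₀ : ∀ x → x < n → region H₁ H₂ x 0 ≡ false
  on-row₀ x x<n = below x 0 (subst (_< suc n) (sym (value₀ x)) (ℕₚ.m<n⇒m<1+n x<n))

  on-row₁ : ∀ x → 1 ≤ x → x ≤ 3 → region H₁ H₂ x 1 ≡ true
  on-row₁ x 1≤x x≤3 = inside x 1 (subst (suc n ≤_) (sym (value₁ x)) (ℕₚ.+-monoˡ-≤ n 1≤x))
                                 (subst (_≤ 3 + n) (sym (value₁ x)) (ℕₚ.+-monoˡ-≤ n x≤3))

  above-row₁ : ∀ x y → region H₁ H₂ x (2 + y) ≡ false
  above-row₁ x y = above x (2 + y) (subst (3 + n <_) (sym (value₂₊ x y)) (begin-strict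
    3 + n          <⟨ ℕₚ.+-monoˡ-< n (ℕₚ.n<1+n 3) ⟩
    4 + n          ≤⟨ ℕₚ.+-monoˡ-≤ n 4≤n ⟩
    n + n          ≤⟨ ℕₚ.m≤m+n (n + n) _ ⟩
    n + n + (x + y * n) ∎))
    where open ℕₚ.≤-Reasoning

  agrees : Agrees n a b 3 1 (region H₁ H₂)
  agrees (fixed ⟨0,0⟩) x<n _  = on-row₀ 0 x<n
  agrees (fixed ⟨1,0⟩) x<n _  = on-row₀ 1 x<n
  agrees (fixed ⟨2,0⟩) x<n _  = on-row₀ 2 x<n
  agrees (fixed ⟨0,1⟩) _   _  = below 0 1 (subst (_< suc n) (sym (value₁ 0)) ℕₚ.≤-refl)
  agrees (fixed ⟨1,1⟩) _   _  = on-row₁ 1 ℕₚ.≤-refl (ℕₚ.m≤m+n 1 2)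
  agrees (fixed ⟨2,1⟩) _   _  = on-row₁ 2 (ℕₚ.m≤m+n 1 1) (ℕₚ.m≤m+n 2 1)
  agrees (fixed ⟨3,1⟩) _   ≢t = ⊥-elim (≢t (refl , refl))
  agrees (fixed ⟨0,2⟩) _   _  = above-row₁ 0 0
  agrees (row₀ m)      x<n _  = on-row₀ (4 + m) x<n
  agrees (row₂ m)      _   _  = above-row₁ (4 + m) 0
  agrees diagonal      _   _  = above-row₁ (4 + a) (2 + a)
  agrees vertical      _   _  = above-row₁ 1 (2 + b)

  w : Witness n a b 3 1
  w = witness H₁ H₂ (on-row₁ 3 (ℕₚ.m≤m+n 1 2) ℕₚ.≤-refl) agrees

-- With s = 5 + 2M the strip s + 2 ≤ 2x + s y ≤ s + 4 is exactly {(1,1), (2,1), (4+M,0)}; on row 0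
-- it reads 7 + 2M ≤ 2x ≤ 9 + 2M.
module Witness⟨4+M,0⟩ {n a b : ℕ} (M : ℕ) where

  open Window M

  s : ℕ
  s = 5 + 2 * M

  open Strip (affine 0 2 s) (2 + s) (4 + s)

  value₀ : ∀ x → eval (affine 0 2 s) x 0 ≡ 2 * x
  value₀ x = lemma s x
    where
    lemma : ∀ s x → 0 + 2 * x + s * 0 ≡ 2 * x
    lemma = solve-∀

  value₁ : ∀ x → eval (affine 0 2 s) x 1 ≡ 2 * x + s
  value₁ x = lemma s x
    where
    lemma : ∀ s x → 0 + 2 * x + s * 1 ≡ 2 * x + s
    lemma = solve-∀

  value₂₊ : ∀ x y → eval (affine 0 2 s) x (2 + y) ≡ s + s + (2 * x + y * s)
  value₂₊ x y = lemma s x y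
    where
    lemma : ∀ s x y → 0 + 2 * x + s * (2 + y) ≡ s + s + (2 * x + y * s)
    lemma = solve-∀

  on-row₀ : ∀ x → x ≢ 4 + M → region H₁ H₂ x 0 ≡ false
  on-row₀ x x≢4+M with ℕₚ.<-cmp x (4 + M)
  ... | tri< x<4+M _ _ = below x 0 (subst (_< 2 + s) (sym (value₀ x)) (below-window x<4+M))
  ... | tri≈ _ x≡4+M _ = ⊥-elim (x≢4+M x≡4+M)
  ... | tri> _ _ 4+M<x = above x 0 (subst (4 + s <_) (sym (value₀ x)) (above-window 4+M<x))

  above-row₁ : ∀ x y → region H₁ H₂ x (2 + y) ≡ false
  above-row₁ x y = above x (2 + y) (subst (4 + s <_) (sym (value₂₊ x y)) (begin-strict
    4 + s                ≡⟨⟩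
    9 + 2 * M            <⟨ ℕₚ.n<1+n _ ⟩
    5 + s                ≤⟨ ℕₚ.+-monoˡ-≤ s (ℕₚ.m≤m+n 5 (2 * M)) ⟩
    s + s                ≤⟨ ℕₚ.m≤m+n (s + s) _ ⟩
    s + s + (2 * x + y * s) ∎))
    where open ℕₚ.≤-Reasoning

  agrees : Agrees n a b (4 + M) 0 (region H₁ H₂)
  agrees (fixed ⟨0,0⟩) _ _  = on-row₀ 0 (λ ())
  agrees (fixed ⟨1,0⟩) _ _  = on-row₀ 1 (λ ())
  agrees (fixed ⟨2,0⟩) _ _  = on-row₀ 2 (λ ())
  agrees (fixed ⟨0,1⟩) _ _  = below 0 1 (subst (_< 2 + s) (sym (value₁ 0)) (ℕₚ.m<n⇒m<1+n (ℕₚ.n<1+n s)))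
  agrees (fixed ⟨1,1⟩) _ _  = inside 1 1 (ℕₚ.≤-reflexive (sym (value₁ 1)))
                                         (subst (_≤ 4 + s) (sym (value₁ 1)) (ℕₚ.+-monoˡ-≤ s (ℕₚ.m≤m+n 2 2)))
  agrees (fixed ⟨2,1⟩) _ _  = inside 2 1 (subst (2 + s ≤_) (sym (value₁ 2)) (ℕₚ.+-monoˡ-≤ s (ℕₚ.m≤m+n 2 2)))
                                         (ℕₚ.≤-reflexive (value₁ 2))
  agrees (fixed ⟨3,1⟩) _ _  = above 3 1 (subst (4 + s <_) (sym (value₁ 3))
                                              (ℕₚ.+-monoˡ-< s (ℕₚ.<-trans (ℕₚ.n<1+n 4) (ℕₚ.n<1+n 5))))
  agrees (fixed ⟨0,2⟩) _ _  = above-row₁ 0 0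
  agrees (row₀ m)      _ ≢t = on-row₀ (4 + m) (λ 4+m≡4+M → ≢t (4+m≡4+M , refl))
  agrees (row₂ m)      _ _  = above-row₁ (4 + m) 0
  agrees diagonal      _ _  = above-row₁ (4 + a) (2 + a)
  agrees vertical      _ _  = above-row₁ 1 (2 + b)

  w : Witness n a b (4 + M) 0
  w = witness H₁ H₂ (inside (4 + M) 0 (subst (2 + s ≤_) (sym (value₀ (4 + M))) (proj₁ in-window))
                                      (subst (_≤ 4 + s) (sym (value₀ (4 + M))) (proj₂ in-window))) agrees

-- s (y − 1) + 2 ≤ 2x ≤ s (y − 1) + 4 with s = 5 + 2M: empty on row 0, x ∈ {1, 2} on row 1,
-- x = 4 + M on row 2, and x > y above row 2, away from the ray points of T⋆.
module Witness⟨4+M,2⟩ {n a b : ℕ} (M : ℕ) where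

  open Window M

  s : ℕ
  s = 5 + 2 * M

  H₁ H₂ : Ineq
  H₁ = affine 2 0 s ≼ affine s 2 0
  H₂ = affine s 2 0 ≼ affine 4 0 s

  open Region H₁ H₂

  lower : ∀ x y → eval (affine 2 0 s) x y ≡ 2 + y * s
  lower x y = lemma s x y
    where
    lemma : ∀ s x y → 2 + 0 * x + s * y ≡ 2 + y * s
    lemma = solve-∀

  middle : ∀ x y → eval (affine s 2 0) x y ≡ s + 2 * x
  middle x y = lemma s x y
    where
    lemma : ∀ s x y → s + 2 * x + 0 * y ≡ s + 2 * x
    lemma = solve-∀

  upper : ∀ x y → eval (affine 4 0 s) x y ≡ 4 + y * s
  upper x y = lemma s x y
    where
    lemma : ∀ s x y → 4 + 0 * x + s * y ≡ 4 + y * s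
    lemma = solve-∀

  below : ∀ x y → s + 2 * x < 2 + y * s → region H₁ H₂ x y ≡ false
  below x y lt = violates₁ x y (ℕₚ.<⇒≱ lt ∘ subst₂ _≤_ (lower x y) (middle x y))

  above : ∀ x y → 4 + y * s < s + 2 * x → region H₁ H₂ x y ≡ false
  above x y lt = violates₂ x y (ℕₚ.<⇒≱ lt ∘ subst₂ _≤_ (middle x y) (upper x y))

  inside : ∀ x y → 2 + y * s ≤ s + 2 * x → s + 2 * x ≤ 4 + y * s → region H₁ H₂ x y ≡ true
  inside x y h₁ h₂ = in-region x y (subst₂ _≤_ (sym (lower x y)) (sym (middle x y)) h₁)
                                   (subst₂ _≤_ (sym (middle x y)) (sym (upper x y)) h₂)

  on-row₀ : ∀ x → region H₁ H₂ x 0 ≡ false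
  on-row₀ x = above x 0 (begin-strict
    4          <⟨ ℕₚ.n<1+n 4 ⟩
    5          ≤⟨ ℕₚ.m≤m+n 5 (2 * M) ⟩
    s          ≤⟨ ℕₚ.m≤m+n s (2 * x) ⟩
    s + 2 * x  ∎)
    where open ℕₚ.≤-Reasoning

  shift₇ : ∀ M → (5 + 2 * M) + (7 + 2 * M) ≡ 2 + 2 * (5 + 2 * M)
  shift₇ = solve-∀

  shift₉ : ∀ M → (5 + 2 * M) + (9 + 2 * M) ≡ 4 + 2 * (5 + 2 * M)
  shift₉ = solve-∀

  on-row₂ : ∀ x → x ≢ 4 + M → region H₁ H₂ x 2 ≡ false
  on-row₂ x x≢4+M with ℕₚ.<-cmp x (4 + M)
  ... | tri< x<4+M _ _ = below x 2 (subst (s + 2 * x <_) (shift₇ M) (ℕₚ.+-monoʳ-< s (below-window x<4+M)))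
  ... | tri≈ _ x≡4+M _ = ⊥-elim (x≢4+M x≡4+M)
  ... | tri> _ _ 4+M<x = above x 2 (subst (_< s + 2 * x) (shift₉ M) (ℕₚ.+-monoʳ-< s (above-window 4+M<x)))

  agrees : Agrees n a b (4 + M) 2 (region H₁ H₂)
  agrees (fixed ⟨0,0⟩) _ _  = on-row₀ 0
  agrees (fixed ⟨1,0⟩) _ _  = on-row₀ 1
  agrees (fixed ⟨2,0⟩) _ _  = on-row₀ 2
  agrees (fixed ⟨0,1⟩) _ _  = below 0 1 (<-by 1 (slack s))
    where
    slack : ∀ s → suc (s + 2 * 0) + 1 ≡ 2 + 1 * s
    slack = solve-∀
  agrees (fixed ⟨1,1⟩) _ _  = inside 1 1 (≤-by 0 (slack₁ s)) (≤-by 2 (slack₂ s))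
    where
    slack₁ : ∀ s → 2 + 1 * s + 0 ≡ s + 2 * 1
    slack₁ = solve-∀
    slack₂ : ∀ s → s + 2 * 1 + 2 ≡ 4 + 1 * s
    slack₂ = solve-∀
  agrees (fixed ⟨2,1⟩) _ _  = inside 2 1 (≤-by 2 (slack₁ s)) (≤-by 0 (slack₂ s))
    where
    slack₁ : ∀ s → 2 + 1 * s + 2 ≡ s + 2 * 2
    slack₁ = solve-∀
    slack₂ : ∀ s → s + 2 * 2 + 0 ≡ 4 + 1 * s
    slack₂ = solve-∀
  agrees (fixed ⟨3,1⟩) _ _  = above 3 1 (<-by 1 (slack s))
    where
    slack : ∀ s → suc (4 + 1 * s) + 1 ≡ s + 2 * 3
    slack = solve-∀
  agrees (fixed ⟨0,2⟩) _ _  = on-row₂ 0 (λ ())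
  agrees (row₀ m)      _ _  = on-row₀ (4 + m)
  agrees (row₂ m)      _ ≢t = on-row₂ (4 + m) (λ 4+m≡4+M → ≢t (4+m≡4+M , refl))
  agrees diagonal      _ _  = below (4 + a) (4 + a) (<-by (8 + 6 * M + 3 * a + 2 * a * M) (slack M a))
    where
    slack : ∀ M a → suc ((5 + 2 * M) + 2 * (4 + a)) + (8 + 6 * M + 3 * a + 2 * a * M) ≡ 2 + (4 + a) * (5 + 2 * M)
    slack = solve-∀
  agrees vertical      _ _  = below 1 (4 + b) (<-by (14 + 6 * M + 5 * b + 2 * b * M) (slack M b))
    where
    slack : ∀ M b → suc ((5 + 2 * M) + 2 * 1) + (14 + 6 * M + 5 * b + 2 * b * M) ≡ 2 + (4 + b) * (5 + 2 * M)
    slack = solve-∀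

  w : Witness n a b (4 + M) 2
  w = witness H₁ H₂ (inside (4 + M) 2 lower-bound upper-bound) agrees
    where
    lower-bound : 2 + 2 * s ≤ s + 2 * (4 + M)
    lower-bound = subst (_≤ s + 2 * (4 + M)) (shift₇ M) (ℕₚ.+-monoʳ-≤ s (proj₁ in-window))
    upper-bound : s + 2 * (4 + M) ≤ 4 + 2 * s
    upper-bound = subst (s + 2 * (4 + M) ≤_) (shift₉ M) (ℕₚ.+-monoʳ-≤ s (proj₂ in-window))

witness-for : ∀ {n a b x y} → 4 ≤ n → TPoint a b x y → Witness n a b x y
witness-for _   (fixed ⟨0,0⟩) = w₀₀
witness-for _   (fixed ⟨1,0⟩) = w₁₀
witness-for _   (fixed ⟨2,0⟩) = w₂₀
witness-for _   (fixed ⟨0,1⟩) = w₀₁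
witness-for _   (fixed ⟨1,1⟩) = w₁₁
witness-for _   (fixed ⟨2,1⟩) = w₂₁
witness-for 4≤n (fixed ⟨3,1⟩) = Witness⟨3,1⟩.w 4≤n
witness-for _   (fixed ⟨0,2⟩) = w₀₂
witness-for _   (row₀ m)      = Witness⟨4+M,0⟩.w m
witness-for _   (row₂ m)      = Witness⟨4+M,2⟩.w m
witness-for _   diagonal      = w-diagonal
witness-for _   vertical      = w-vertical

minimal : ∀ {n a b} → 4 ≤ n → (S : Subset² n) → S ⊂ onGrid (T⋆ a b) → ¬ IsTeachingSet n (onGrid f⋆) S
minimal {n} 4≤n S (S⊆T , (i₀ , j₀) , T∋p₀ , S∌p₀) S-teaches =
  not-¬ (S-teaches (onGrid (region H₁ H₂)) (region∈𝔗 H₁ H₂) agrees-on-S (i₀ , j₀)) flips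
  where
  open Witness (witness-for 4≤n (∈T⋆⇒TPoint (toℕ i₀) (toℕ j₀) T∋p₀))
  agrees-on-S : AgreeOn S (onGrid f⋆) (onGrid (region H₁ H₂))
  agrees-on-S (i , j) S∋p = agrees (∈T⋆⇒TPoint (toℕ i) (toℕ j) (S⊆T (i , j) S∋p)) (toℕ<n i) p≢p₀
    where
    p≢p₀ : ¬ (toℕ i ≡ toℕ i₀ × toℕ j ≡ toℕ j₀)
    p≢p₀ (i≡i₀ , j≡j₀) = true≢false (trans (sym S∋p₀) S∌p₀)
      where
      S∋p₀ : S (i₀ , j₀) ≡ true
      S∋p₀ = subst (λ p → S p ≡ true) (cong₂ _,_ (toℕ-injective i≡i₀) (toℕ-injective j≡j₀)) S∋p

T⋆-minimal : ∀ {n a b} → 5 ≤ n → 4 + a < n → 4 + b < n → IsMinimalTeachingSet n (onGrid f⋆) (onGrid (T⋆ a b))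
T⋆-minimal 5≤n 4+a<n 4+b<n = teaches 5≤n 4+a<n 4+b<n , minimal (ℕₚ.≤-trans (ℕₚ.n≤1+n 4) 5≤n)

InT-resp : ∀ {n g g′} → (∀ z → g z ≡ g′ z) → InT n g → InT n g′
InT-resp g≗g′ (h₁ , h₂ , g⇔) = h₁ , h₂ , λ z → subst (λ v → (v ≡ true) ⇔ _) (g≗g′ z) (g⇔ z)

-- 5y ≤ x + 4 and x + 1 ≤ 3y together force y = 1 and 1 ≤ x ≤ 2.
F₁ F₂ : Ineq
F₁ = affine 0 0 5 ≼ affine 4 1 0
F₂ = affine 1 1 0 ≼ affine 0 0 3

f⋆-above-row₁ : ∀ x y → f⋆ x (2 + y) ≡ false
f⋆-above-row₁ 0                   _ = refl
f⋆-above-row₁ 1                   _ = refl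
f⋆-above-row₁ 2                   _ = refl
f⋆-above-row₁ (suc (suc (suc _))) _ = refl

F-above-row₁ : ∀ x y → region F₁ F₂ x (2 + y) ≡ false
F-above-row₁ x y = ¬-not (λ in-F →
  let (h₁ , h₂) = Equivalence.to (in-region⇔ x (2 + y)) in-F
  in ℕₚ.m+1+n≰m (10 + x + 3 * y) (subst₂ _≤_ (lhs x y) (rhs x y) (ℕₚ.+-mono-≤ h₁ h₂)))
  where
  open Region F₁ F₂
  lhs : ∀ x y → (0 + 0 * x + 5 * (2 + y)) + (1 + 1 * x + 0 * (2 + y)) ≡ (10 + x + 3 * y) + suc (2 * y)
  lhs = solve-∀
  rhs : ∀ x y → (4 + 1 * x + 0 * (2 + y)) + (0 + 0 * x + 3 * (2 + y)) ≡ 10 + x + 3 * y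
  rhs = solve-∀

F≗f⋆ : ∀ x y → region F₁ F₂ x y ≡ f⋆ x y
F≗f⋆ 0                   0             = refl
F≗f⋆ 1                   0             = refl
F≗f⋆ 2                   0             = refl
F≗f⋆ (suc (suc (suc x))) 0             = refl
F≗f⋆ 0                   1             = refl
F≗f⋆ 1                   1             = refl
F≗f⋆ 2                   1             = refl
F≗f⋆ (suc (suc (suc x))) 1             = refl
F≗f⋆ x                   (suc (suc y)) = trans (F-above-row₁ x y) (sym (f⋆-above-row₁ x y))

f⋆∈𝔗 : ∀ {n} → InT n (onGrid f⋆)
f⋆∈𝔗 = InT-resp (λ (i , j) → F≗f⋆ (toℕ i) (toℕ j)) (region∈𝔗 F₁ F₂)

T⋆-separated : ∀ {K} {p q p′ q′ : Fin K} → (p , q) ≢ (p′ , q′) →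
  ∃[ z ] (onGrid (T⋆ (toℕ p) (toℕ q)) z ≢ onGrid (T⋆ (toℕ p′) (toℕ q′)) z)
T⋆-separated {K} {p} {q} {p′} {q′} pq≢p′q′ with toℕ p ℕₚ.≟ toℕ p′
... | no  p≢p′ = (4 ↑ʳ p , 4 ↑ʳ p) , λ eq →
  true≢false (trans (sym (TPoint⇒∈T⋆ {toℕ p} {toℕ q} diagonal))
                    (trans eq (diagonal∉T⋆ {b = toℕ q′} p≢p′)))
... | yes p≡p′ = (suc zero , 4 ↑ʳ q) , λ eq →
  true≢false (trans (sym (TPoint⇒∈T⋆ {toℕ p} {toℕ q} vertical))
                    (trans eq (vertical∉T⋆ {a = toℕ p′} q≢q′)))
  where
  q≢q′ : toℕ q ≢ toℕ q′
  q≢q′ q≡q′ = pq≢p′q′ (cong₂ _,_ (toℕ-injective p≡p′) (toℕ-injective q≡q′))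

quadratically-many : ∀ K → 1 ≤ K → J≥ (4 + K) (onGrid f⋆) (K * K)
quadratically-many K 1≤K = Ts , minimal-Ts , distinct
  where
  Ts : Fin (K * K) → Subset² (4 + K)
  Ts i = let (p , q) = remQuot {K} K i in onGrid (T⋆ (toℕ p) (toℕ q))
  4+toℕ<4+K : (p : Fin K) → 4 + toℕ p < 4 + K
  4+toℕ<4+K p = ℕₚ.+-monoʳ-< 4 (toℕ<n p)
  minimal-Ts : ∀ i → IsMinimalTeachingSet (4 + K) (onGrid f⋆) (Ts i)
  minimal-Ts i = let (p , q) = remQuot {K} K i in T⋆-minimal (ℕₚ.+-monoʳ-≤ 4 1≤K) (4+toℕ<4+K p) (4+toℕ<4+K q)
  distinct : ∀ i j → i ≢ j → ∃[ z ] (Ts i z ≢ Ts j z)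
  distinct i j i≢j = T⋆-separated (λ eq → i≢j (begin
    i                                  ≡⟨ combine-remQuot {K} K i ⟨
    uncurry combine (remQuot {K} K i)  ≡⟨ cong (uncurry combine) eq ⟩
    uncurry combine (remQuot {K} K j)  ≡⟨ combine-remQuot {K} K j ⟩
    j                                  ∎))
    where open ≡-Reasoning

n²≤4[n-4]² : ∀ K → 4 ≤ K → (4 + K) * (4 + K) ≤ 4 * (K * K)
n²≤4[n-4]² K 4≤K = subst ((4 + K) * (4 + K) ≤_) (square K) (ℕₚ.*-mono-≤ 4+K≤K+K 4+K≤K+K)
  where
  4+K≤K+K : 4 + K ≤ K + K
  4+K≤K+K = ℕₚ.+-monoˡ-≤ K 4≤K
  square : ∀ K → (K + K) * (K + K) ≡ 4 * (K * K)
  square = solve-∀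

lemma4 : Σ ℕ λ c → Σ ℕ λ N → (n : ℕ) → N ≤ n →
    ∃[ f ] (InT n f × ∃[ k ] (J≥ n f k × n * n ≤ suc c * k))
lemma4 = 3 , 8 , λ n 8≤n → on-grid n (ℕₚ.m≤n⇒∃[o]m+o≡n (ℕₚ.≤-trans (ℕₚ.m≤m+n 4 4) 8≤n)) 8≤n
  where
  on-grid : ∀ n → Σ ℕ (λ K → 4 + K ≡ n) → 8 ≤ n →
            ∃[ f ] (InT n f × ∃[ k ] (J≥ n f k × n * n ≤ 4 * k))
  on-grid .(4 + K) (K , refl) 8≤4+K =
    onGrid f⋆ , f⋆∈𝔗 , K * K , quadratically-many K (ℕₚ.≤-trans (s≤s z≤n) 4≤K) , n²≤4[n-4]² K 4≤K
    where
    4≤K : 4 ≤ K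
    4≤K = ℕₚ.+-cancelˡ-≤ 4 4 K 8≤4+K
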